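{- (1) For the complete graph $K_n$, the path $P_n$, the cycle $C_n$ ($n\ge 3$) and the wheel $W_n$ ($n\ge 4$), $\mathcal{P}(K_n;x)=\mathcal{P}(P_n;x)=\mathcal{P}(C_n;x)=\mathcal{P}(W_n;x)=(x+1)^n-1$. (2) $\mathcal{P}(\overline{K_n};x)=x^n$. (3) For $n\ge 3$, $\mathcal{P}(S_n;x)=x(x+1)^{n-1}+x^{n-1}+(n-1)x^{n-2}$. (4) For any graph $H$ of order $n$ and any integer $k>1$, $\mathcal{P}(H\circ K_k;x)=\big((x+1)^{k+1}-1\big)^n$.
   Context: Graphs are finite and simple. $\overline{K_n}$ is the edgeless graph on $n$ vertices; $S_n=K_{n-1,1}$ is the star on $n\ge3$ vertices; $W_n=C_{n-1}\vee K_1$ ($n\ge4$) is the wheel, where $\vee$ denotes join. The corona $G_1\circ G_2$ is obtained from one copy of $G_1$ and $n(G_1)$ copies of $G_2$ by joining the $i$-th vertex of $G_1$ to every vertex of the $i$-th copy of $G_2$. For $S\subseteq V(G)$, $S$ is a power dominating set if, after coloring $S$, coloring every neighbor of a vertex of $S$, and then repeatedly applying the forcing rule (a colored vertex with exactly one uncolored neighbor colors that neighbor) until no changes occur, all vertices are colored. $\mathcal{P}(G;x)=\sum_{i=1}^{|V(G)|} p(G;i)x^i$, with $p(G;i)$ the number of power dominating sets of size $i$. -}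

module Defs where

open import Data.Bool using (Bool; true; false; _∧_; _∨_; not; if_then_else_)
open import Data.Nat as ℕ using (ℕ; zero; suc; _≡ᵇ_; _∸_)
open import Data.Fin as Fin using (Fin; zero; suc; toℕ; remQuot)
open import Data.Product using (_×_; _,_)
open import Data.List using (List; []; _∷_; map; concatMap)
open import Data.Nat.ListAction using (sum)
open import Data.Integer as ℤ using (ℤ; +_)
open import Relation.Nullary.Decidable using (isYes)
open import Relation.Binary.PropositionalEquality using (_≡_)

Adj : ℕ → Set
Adj n = Fin n → Fin n → Bool

record IsSimple {n : ℕ} (G : Adj n) : Set where
  field
    symmetric  : ∀ i j → G i j ≡ G j i
    irreflexive : ∀ i → G i i ≡ false

_==F_ : ∀ {n} → Fin n → Fin n → Bool
i ==F j = isYes (i Fin.≟ j)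

anyF : ∀ {n} → (Fin n → Bool) → Bool
anyF {zero}  f = false
anyF {suc n} f = f zero ∨ anyF (λ i → f (suc i))

allF : ∀ {n} → (Fin n → Bool) → Bool
allF {zero}  f = true
allF {suc n} f = f zero ∧ allF (λ i → f (suc i))

Subset : ℕ → Set
Subset n = Fin n → Bool

domStep : ∀ {n} → Adj n → Subset n → Subset n
domStep G S v = S v ∨ anyF (λ u → S u ∧ G u v)

-- one (parallel) round of the forcing rule: a colored vertex u all of
-- whose neighbors other than v are colored (i.e. v is its unique uncolored
-- neighbor, if v is uncolored) colors v.
forceStep : ∀ {n} → Adj n → Subset n → Subset n
forceStep G C v =
  C v ∨ anyF (λ u → C u ∧ G u v ∧ allF (λ w → not (G u w) ∨ (w ==F v) ∨ C w))

iter : ∀ {A : Set} → ℕ → (A → A) → A → A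
iter zero    f a = a
iter (suc k) f a = f (iter k f a)

-- Since each non-stable round colors at least one new vertex, n rounds
-- reach the point where no further changes occur.
observed : ∀ {n} → Adj n → Subset n → Subset n
observed {n} G S = iter n (forceStep G) (domStep G S)

isPDS : ∀ {n} → Adj n → Subset n → Bool
isPDS G S = allF (observed G S)

size : ∀ {n} → Subset n → ℕ
size {zero}  S = 0
size {suc n} S = (if S zero then 1 else 0) ℕ.+ size (λ i → S (suc i))

allSubsets : ∀ n → List (Subset n)
allSubsets zero    = (λ ()) ∷ []
allSubsets (suc n) = concatMap (λ S → ext false S ∷ ext true S ∷ []) (allSubsets n)
  where
  ext : Bool → Subset n → Subset (suc n)
  ext b S zero    = b
  ext b S (suc i) = S i

p : ∀ {n} → Adj n → ℕ → ℕ
p {n} G i = sum (map (λ S → if isPDS G S ∧ (size S ≡ᵇ i) then 1 else 0) (allSubsets n))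

Poly : Set
Poly = ℕ → ℤ

PDP : ∀ {n} → Adj n → Poly
PDP G zero    = + 0
PDP G (suc i) = + p G (suc i)

const : ℤ → Poly
const c zero    = c
const c (suc i) = + 0

X : Poly
X zero          = + 0
X (suc zero)    = + 1
X (suc (suc i)) = + 0

infixl 6 _⊕_ _⊖_
infixl 7 _⊗_
infixr 8 _^P_
infix 4 _≈P_

_⊕_ : Poly → Poly → Poly
(f ⊕ g) i = f i ℤ.+ g i

_⊖_ : Poly → Poly → Poly
(f ⊖ g) i = f i ℤ.- g i

sumTo : ℕ → (ℕ → ℤ) → ℤ
sumTo zero    h = h zero
sumTo (suc k) h = sumTo k h ℤ.+ h (suc k)

_⊗_ : Poly → Poly → Poly
(f ⊗ g) k = sumTo k (λ j → f j ℤ.* g (k ∸ j))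

_^P_ : Poly → ℕ → Poly
f ^P zero  = const (+ 1)
f ^P suc m = f ⊗ (f ^P m)

_≈P_ : Poly → Poly → Set
f ≈P g = ∀ i → f i ≡ g i

complete : ∀ n → Adj n
complete n i j = not (i ==F j)

edgeless : ∀ n → Adj n
edgeless n i j = false

path : ∀ n → Adj n
path n i j = (toℕ j ≡ᵇ suc (toℕ i)) ∨ (toℕ i ≡ᵇ suc (toℕ j))

-- cycle 0 - 1 - ... - (n-1) - 0   (meant for n ≥ 3)
cycle : ∀ n → Adj n
cycle n i j = path n i j
  ∨ ((toℕ i ≡ᵇ 0) ∧ (toℕ j ≡ᵇ n ∸ 1))
  ∨ ((toℕ j ≡ᵇ 0) ∧ (toℕ i ≡ᵇ n ∸ 1))

-- wheel W_n = C_{n-1} ∨ K_1: vertex zero is the hub, the others form C_{n-1}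
wheel : ∀ n → Adj n
wheel zero    ()
wheel (suc m) zero    zero    = false
wheel (suc m) zero    (suc j) = true
wheel (suc m) (suc i) zero    = true
wheel (suc m) (suc i) (suc j) = cycle m i j

-- star S_n = K_{n-1,1}: vertex zero is the center
star : ∀ n → Adj n
star zero    ()
star (suc m) zero    zero    = false
star (suc m) zero    (suc j) = true
star (suc m) (suc i) zero    = true
star (suc m) (suc i) (suc j) = false

-- corona H ∘ K_k.  Vertices are Fin (n * suc k) ≅ Fin n × Fin (suc k):
-- (i , zero) is vertex i of H, (i , suc a) is vertex a of the i-th copy of K_k.
corona : ∀ {n} → Adj n → ∀ k → Adj (n ℕ.* suc k)
corona {n} H k x y = go (remQuot (suc k) x) (remQuot (suc k) y)
  where
  go : Fin n × Fin (suc k) → Fin n × Fin (suc k) → Bool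
  go (i , zero)  (j , zero)  = H i j
  go (i , zero)  (j , suc b) = i ==F j
  go (i , suc a) (j , zero)  = i ==F j
  go (i , suc a) (j , suc b) = (i ==F j) ∧ not (a ==F b)

module Submission where

-- Every formula follows from a characterisation of the power dominating
-- sets: for K_n, P_n, C_n and W_n they are the nonempty sets, for the
-- edgeless graph only the full set, for the star the sets containing the
-- center or missing at most one leaf, and for H ∘ K_k the sets meeting each
-- of the n blocks {v} ∪ K_k.  Such a characterisation turns the polynomial
-- into the generating function of a counting problem on subsets.
--
-- The characterisations come next; the
-- path, cycle and wheel cases share one argument: a set containing a vertex
-- of a cycle-like graph forces its way along the cycle in both directions.

open import Defs
open import Data.Nat using (ℕ; suc; _≤_; _<_; _∸_; _+_; s≤s)
open import Data.Integer using (+_)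
open import Data.Product using (_×_; _,_)

module BooleanReflection where

  open import Data.Bool using (Bool; true; false; _∧_; _∨_; not; T)
  open import Data.Unit using (tt)
  open import Data.Nat using (ℕ; zero; suc; _≡ᵇ_)
  open import Data.Nat.Properties using (≡ᵇ⇒≡)
  open import Data.Fin as Fin using (Fin; zero; suc)
  open import Data.Product using (∃; _,_)
  open import Data.Sum using (_⊎_; inj₁; inj₂)
  open import Data.Empty using (⊥-elim)
  open import Relation.Nullary using (¬_; yes; no)
  open import Relation.Binary.PropositionalEquality

  true≢false : true ≢ false
  true≢false ()

  ∨-introˡ : ∀ {a} b → a ≡ true → a ∨ b ≡ true
  ∨-introˡ b refl = refl

  ∨-introʳ : ∀ a {b} → b ≡ true → a ∨ b ≡ true
  ∨-introʳ true  refl = refl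
  ∨-introʳ false refl = refl

  ∨-elim : ∀ a b → a ∨ b ≡ true → a ≡ true ⊎ b ≡ true
  ∨-elim true  b e = inj₁ refl
  ∨-elim false b e = inj₂ e

  ∨-false : ∀ {a b} → a ≡ false → b ≡ false → a ∨ b ≡ false
  ∨-false refl refl = refl

  ∧-intro : ∀ {a b} → a ≡ true → b ≡ true → a ∧ b ≡ true
  ∧-intro refl refl = refl

  ∧-elimˡ : ∀ a b → a ∧ b ≡ true → a ≡ true
  ∧-elimˡ true b e = refl

  ∧-elimʳ : ∀ a b → a ∧ b ≡ true → b ≡ true
  ∧-elimʳ true b e = e

  not-intro : ∀ {a} → a ≡ false → not a ≡ true
  not-intro refl = refl

  ¬true⇒false : ∀ {a} → ¬ (a ≡ true) → a ≡ false
  ¬true⇒false {true}  h = ⊥-elim (h refl)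
  ¬true⇒false {false} h = refl

  ≡ᵇ-true : ∀ {m n} → m ≡ n → (m ≡ᵇ n) ≡ true
  ≡ᵇ-true {zero}  refl = refl
  ≡ᵇ-true {suc m} refl = ≡ᵇ-true {m} refl

  ≡ᵇ-sound : ∀ m n → (m ≡ᵇ n) ≡ true → m ≡ n
  ≡ᵇ-sound m n e = ≡ᵇ⇒≡ m n (subst T (sym e) tt)

  ≡ᵇ-false : ∀ m n → m ≢ n → (m ≡ᵇ n) ≡ false
  ≡ᵇ-false m n ne = ¬true⇒false (λ e → ne (≡ᵇ-sound m n e))

  ==F-refl : ∀ {n} (i : Fin n) → (i ==F i) ≡ true
  ==F-refl i with i Fin.≟ i
  ... | yes _ = refl
  ... | no ne = ⊥-elim (ne refl)

  ==F-sound : ∀ {n} (i j : Fin n) → (i ==F j) ≡ true → i ≡ j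
  ==F-sound i j e with i Fin.≟ j
  ... | yes p = p

  ==F-false : ∀ {n} (i j : Fin n) → i ≢ j → (i ==F j) ≡ false
  ==F-false i j ne = ¬true⇒false (λ e → ne (==F-sound i j e))

  anyF-intro : ∀ {n} (f : Fin n → Bool) i → f i ≡ true → anyF f ≡ true
  anyF-intro f zero    e = ∨-introˡ _ e
  anyF-intro f (suc i) e = ∨-introʳ (f zero) (anyF-intro (λ j → f (suc j)) i e)

  anyF-elim : ∀ {n} (f : Fin n → Bool) → anyF f ≡ true → ∃ λ i → f i ≡ true
  anyF-elim {suc n} f e with ∨-elim (f zero) _ e
  ... | inj₁ p = zero , p
  ... | inj₂ p with anyF-elim (λ j → f (suc j)) p
  ... | i , q = suc i , q

  anyF-false-elim : ∀ {n} (f : Fin n → Bool) → anyF f ≡ false → ∀ i → f i ≡ false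
  anyF-false-elim f e i = ¬true⇒false (λ fi → true≢false (trans (sym (anyF-intro f i fi)) e))

  allF-intro : ∀ {n} (f : Fin n → Bool) → (∀ i → f i ≡ true) → allF f ≡ true
  allF-intro {zero}  f h = refl
  allF-intro {suc n} f h = ∧-intro (h zero) (allF-intro (λ j → f (suc j)) (λ j → h (suc j)))

  allF-elim : ∀ {n} (f : Fin n → Bool) → allF f ≡ true → ∀ i → f i ≡ true
  allF-elim {suc n} f e zero    = ∧-elimˡ _ _ e
  allF-elim {suc n} f e (suc i) = allF-elim (λ j → f (suc j)) (∧-elimʳ (f zero) _ e) i

  allF-false-elim : ∀ {n} (f : Fin n → Bool) → allF f ≡ false → ∃ λ i → f i ≡ false
  allF-false-elim {suc n} f e with f zero in eq
  ... | false = zero , eq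
  ... | true with allF-false-elim (λ j → f (suc j)) e
  ... | i , q = suc i , q

  anyF-cong : ∀ {n} {f g : Fin n → Bool} → (∀ i → f i ≡ g i) → anyF f ≡ anyF g
  anyF-cong {zero}  h = refl
  anyF-cong {suc n} h = cong₂ _∨_ (h zero) (anyF-cong (λ j → h (suc j)))

  allF-cong : ∀ {n} {f g : Fin n → Bool} → (∀ i → f i ≡ g i) → allF f ≡ allF g
  allF-cong {zero}  h = refl
  allF-cong {suc n} h = cong₂ _∧_ (h zero) (allF-cong (λ j → h (suc j)))

module PowerDomination where

  open BooleanReflection
  open import Data.Bool using (Bool; true; false; _∧_; _∨_; not)
  open import Data.Nat using (ℕ; zero; suc; _≤_; z≤n; s≤s)
  open import Data.Fin using (Fin; zero; suc)
  open import Data.Product using (Σ; _×_; _,_)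
  open import Data.Sum using (_⊎_; inj₁; inj₂)
  open import Data.Empty using (⊥-elim)
  open import Relation.Binary.PropositionalEquality

  infix 4 _⊆_

  _⊆_ : ∀ {n} → Subset n → Subset n → Set
  C ⊆ D = ∀ x → C x ≡ true → D x ≡ true

  Forces : ∀ {n} → Adj n → Subset n → Fin n → Fin n → Bool
  Forces G C u v = C u ∧ G u v ∧ allF (λ w → not (G u w) ∨ (w ==F v) ∨ C w)

  dominated-by : ∀ {n} (G : Adj n) S u x → S u ≡ true → G u x ≡ true → domStep G S x ≡ true
  dominated-by G S u x su g = ∨-introʳ (S x) (anyF-intro (λ u → S u ∧ G u x) u (∧-intro su g))

  forced-by : ∀ {n} (G : Adj n) C u v → C u ≡ true → G u v ≡ true →
              (∀ w → (not (G u w) ∨ (w ==F v) ∨ C w) ≡ true) → forceStep G C v ≡ true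
  forced-by G C u v cu g h =
    ∨-introʳ (C v) (anyF-intro (λ u → Forces G C u v) u (∧-intro cu (∧-intro g (allF-intro _ h))))

  dominated-elim : ∀ {n} (G : Adj n) S x → domStep G S x ≡ true →
                   S x ≡ true ⊎ Σ (Fin n) (λ u → S u ∧ G u x ≡ true)
  dominated-elim G S x h with ∨-elim (S x) _ h
  ... | inj₁ p = inj₁ p
  ... | inj₂ p = inj₂ (anyF-elim (λ u → S u ∧ G u x) p)

  forced-elim : ∀ {n} (G : Adj n) C v → forceStep G C v ≡ true →
                C v ≡ true ⊎ Σ (Fin n) (λ u → C u ≡ true × G u v ≡ true ×
                                   (∀ w → (not (G u w) ∨ (w ==F v) ∨ C w) ≡ true))
  forced-elim G C v h with ∨-elim (C v) _ h
  ... | inj₁ p = inj₁ p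
  ... | inj₂ p with anyF-elim (λ u → Forces G C u v) p
  ... | u , q = inj₂ (u , ∧-elimˡ (C u) _ q , ∧-elimˡ (G u v) _ (∧-elimʳ (C u) _ q)
                        , allF-elim _ (∧-elimʳ (G u v) _ (∧-elimʳ (C u) _ q)))

  domStep-⊇ : ∀ {n} (G : Adj n) S → S ⊆ domStep G S
  domStep-⊇ G S x e = ∨-introˡ _ e

  forceStep-⊇ : ∀ {n} (G : Adj n) C → C ⊆ forceStep G C
  forceStep-⊇ G C x e = ∨-introˡ _ e

  forceStep-mono : ∀ {n} (G : Adj n) {C D} → C ⊆ D → forceStep G C ⊆ forceStep G D
  forceStep-mono G {C} {D} C⊆D v h with forced-elim G C v h
  ... | inj₁ cv = forceStep-⊇ G D v (C⊆D v cv)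
  ... | inj₂ (u , cu , guv , rest) = forced-by G D u v (C⊆D u cu) guv (λ w → widen w (rest w))
    where
    widen : ∀ w → (not (G u w) ∨ (w ==F v) ∨ C w) ≡ true → (not (G u w) ∨ (w ==F v) ∨ D w) ≡ true
    widen w e with ∨-elim (not (G u w)) _ e
    ... | inj₁ p = ∨-introˡ _ p
    ... | inj₂ p with ∨-elim (w ==F v) _ p
    ... | inj₁ q = ∨-introʳ (not (G u w)) (∨-introˡ _ q)
    ... | inj₂ q = ∨-introʳ (not (G u w)) (∨-introʳ (w ==F v) (C⊆D w q))

  round : ∀ {n} → Adj n → Subset n → ℕ → Subset n
  round G S r = iter r (forceStep G) (domStep G S)

  round-mono : ∀ {n} (G : Adj n) S {r s} → r ≤ s → round G S r ⊆ round G S s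
  round-mono G S {zero}  {zero}  z≤n     = λ x e → e
  round-mono G S {zero}  {suc s} z≤n     =
    λ x e → forceStep-⊇ G (round G S s) x (round-mono G S {zero} {s} z≤n x e)
  round-mono G S {suc r} {suc s} (s≤s le) = forceStep-mono G (round-mono G S le)

  round⊆observed : ∀ {n} (G : Adj n) S {r} → r ≤ n → round G S r ⊆ observed G S
  round⊆observed G S = round-mono G S

  observed-least : ∀ {n} (G : Adj n) S D → domStep G S ⊆ D → forceStep G D ⊆ D → observed G S ⊆ D
  observed-least {n} G S D dom⊆D closed = within n
    where
    within : ∀ r → round G S r ⊆ D
    within zero    = dom⊆D
    within (suc r) x e = closed x (forceStep-mono G (within r) x e)

  PDS-intro : ∀ {n} (G : Adj n) S → (∀ x → observed G S x ≡ true) → isPDS G S ≡ true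
  PDS-intro G S = allF-intro _

  PDS-refute : ∀ {n} (G : Adj n) S D x → domStep G S ⊆ D → forceStep G D ⊆ D → D x ≡ false →
               isPDS G S ≡ false
  PDS-refute G S D x dom⊆D closed dx = ¬true⇒false λ pds →
    true≢false (trans (sym (observed-least G S D dom⊆D closed x (allF-elim _ pds x))) dx)

  dominating⇒PDS : ∀ {n} (G : Adj n) S → (∀ x → domStep G S x ≡ true) → isPDS G S ≡ true
  dominating⇒PDS G S dom = PDS-intro G S (λ x → round⊆observed G S z≤n x (dom x))

  -- On a nonempty vertex set, the empty set is not power dominating:
  -- the empty coloring is closed under both steps.
  empty-not-PDS : ∀ {n} (G : Adj (suc n)) S → anyF S ≡ false → isPDS G S ≡ false
  empty-not-PDS G S empty = PDS-refute G S (λ _ → false) zero nothing-dominated nothing-forced refl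
    where
    S-false = anyF-false-elim S empty
    nothing-dominated : domStep G S ⊆ (λ _ → false)
    nothing-dominated x h with dominated-elim G S x h
    ... | inj₁ sx      = ⊥-elim (true≢false (trans (sym sx) (S-false x)))
    ... | inj₂ (u , q) = ⊥-elim (true≢false (trans (sym (∧-elimˡ (S u) _ q)) (S-false u)))
    nothing-forced : forceStep G (λ _ → false) ⊆ (λ _ → false)
    nothing-forced x h with forced-elim G (λ _ → false) x h
    ... | inj₁ ()
    ... | inj₂ (u , () , _)

module CoefficientSequences where

  open import Data.Nat using (ℕ; zero; suc; _+_; _*_; _∸_)
  open import Data.Nat.Properties using (+-identityʳ; *-zeroʳ; *-identityˡ)
  open import Relation.Binary.PropositionalEquality

  Seq : Set
  Seq = ℕ → ℕ

  shift : Seq → Seq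
  shift g zero    = 0
  shift g (suc k) = g k

  dropConst : Seq → Seq
  dropConst g zero    = 0
  dropConst g (suc k) = g (suc k)

  δ : ℕ → Seq
  δ zero    zero    = 1
  δ zero    (suc k) = 0
  δ (suc n)         = shift (δ n)

  choose : ℕ → Seq
  choose zero          = δ zero
  choose (suc n) k     = choose n k + shift (choose n) k

  lin : ℕ → ℕ → Seq
  lin a b zero          = a
  lin a b (suc zero)    = b
  lin a b (suc (suc k)) = 0

  shift-cong : ∀ {f g : Seq} → (∀ k → f k ≡ g k) → ∀ k → shift f k ≡ shift g k
  shift-cong e zero    = refl
  shift-cong e (suc k) = e k

  Σ≤ : ℕ → (ℕ → ℕ) → ℕ
  Σ≤ zero    h = h zero
  Σ≤ (suc k) h = Σ≤ k h + h (suc k)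

  _✶_ : Seq → Seq → Seq
  (f ✶ g) k = Σ≤ k (λ j → f j * g (k ∸ j))

  Σ≤-cong : ∀ k {h h' : ℕ → ℕ} → (∀ j → h j ≡ h' j) → Σ≤ k h ≡ Σ≤ k h'
  Σ≤-cong zero    e = e zero
  Σ≤-cong (suc k) e = cong₂ _+_ (Σ≤-cong k e) (e (suc k))

  Σ≤-zero : ∀ k (h : ℕ → ℕ) → (∀ j → h j ≡ 0) → Σ≤ k h ≡ 0
  Σ≤-zero zero    h e = e zero
  Σ≤-zero (suc k) h e rewrite Σ≤-zero k h e | e (suc k) = refl

  Σ≤-two-terms : ∀ k (h : ℕ → ℕ) → (∀ j → h (suc (suc j)) ≡ 0) → Σ≤ (suc k) h ≡ h 0 + h 1
  Σ≤-two-terms zero    h e = refl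
  Σ≤-two-terms (suc k) h e rewrite Σ≤-two-terms k h e | e k = +-identityʳ _

  lin-✶ : ∀ a b g k → (lin a b ✶ g) k ≡ a * g k + b * shift g k
  lin-✶ a b g zero    = sym (trans (cong (_+_ (a * g 0)) (*-zeroʳ b)) (+-identityʳ (a * g 0)))
  lin-✶ a b g (suc k) = Σ≤-two-terms k _ (λ j → refl)

  choose-suc : ∀ n k → choose (suc n) k ≡ (lin 1 1 ✶ choose n) k
  choose-suc n k = sym (trans (lin-✶ 1 1 (choose n) k)
    (cong₂ _+_ (*-identityˡ (choose n k)) (*-identityˡ (shift (choose n) k))))

  δ-suc : ∀ n k → δ (suc n) k ≡ (lin 0 1 ✶ δ n) k
  δ-suc n k = sym (trans (lin-✶ 0 1 (δ n) k) (*-identityˡ (shift (δ n) k)))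

module SubsetCounting where

  open BooleanReflection
  open CoefficientSequences
  open import Data.Bool using (Bool; true; false; _∧_; if_then_else_)
  open import Data.Bool.Properties using (∧-zeroʳ)
  open import Data.Nat using (ℕ; zero; suc; _+_; _*_; _≡ᵇ_)
  open import Data.Nat.Properties using (+-assoc; +-identityʳ; *-zeroʳ; *-distribʳ-+; +-commutativeSemigroup)
  open import Algebra.Properties.CommutativeSemigroup +-commutativeSemigroup using ()
    renaming (interchange to +-interchange; x∙yz≈y∙xz to +-exchangeˡ)
  open import Data.Nat.ListAction using (sum)
  open import Data.List using (List; []; _∷_; map; concatMap)
  open import Data.List.Properties using (map-cong)
  open import Data.Fin using (Fin; zero; suc)
  open import Relation.Binary.PropositionalEquality

  Extensional : ∀ {N} {A : Set} → (Subset N → A) → Set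
  Extensional {N} f = ∀ {S T : Subset N} → (∀ x → S x ≡ T x) → f S ≡ f T

  ind : Bool → ℕ
  ind b = if b then 1 else 0

  Σ[_] : ∀ {A : Set} → List A → (A → ℕ) → ℕ
  Σ[ xs ] f = sum (map f xs)

  Σ-cong : ∀ {A : Set} (xs : List A) {f g : A → ℕ} → (∀ a → f a ≡ g a) → Σ[ xs ] f ≡ Σ[ xs ] g
  Σ-cong xs h = cong sum (map-cong h xs)

  Σ-+ : ∀ {A : Set} (xs : List A) (f g : A → ℕ) → Σ[ xs ] (λ a → f a + g a) ≡ Σ[ xs ] f + Σ[ xs ] g
  Σ-+ []       f g = refl
  Σ-+ (x ∷ xs) f g rewrite Σ-+ xs f g = +-interchange (f x) (g x) (Σ[ xs ] f) (Σ[ xs ] g)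

  Σ-*ʳ : ∀ {A : Set} (xs : List A) (f : A → ℕ) c → Σ[ xs ] f * c ≡ Σ[ xs ] (λ a → f a * c)
  Σ-*ʳ []       f c = refl
  Σ-*ʳ (x ∷ xs) f c = trans (*-distribʳ-+ c (f x) _) (cong (_+_ (f x * c)) (Σ-*ʳ xs f c))

  Σ-zero : ∀ {A : Set} (xs : List A) (f : A → ℕ) → (∀ a → f a ≡ 0) → Σ[ xs ] f ≡ 0
  Σ-zero []       f h = refl
  Σ-zero (x ∷ xs) f h rewrite h x = Σ-zero xs f h

  Σ≤-Σ : ∀ {A : Set} (xs : List A) k (h : ℕ → A → ℕ) →
         Σ≤ k (λ j → Σ[ xs ] (h j)) ≡ Σ[ xs ] (λ a → Σ≤ k (λ j → h j a))
  Σ≤-Σ xs zero    h = refl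
  Σ≤-Σ xs (suc k) h = trans (cong (_+ Σ[ xs ] (h (suc k))) (Σ≤-Σ xs k h))
                            (sym (Σ-+ xs (λ a → Σ≤ k (λ j → h j a)) (h (suc k))))

  cons : ∀ {N} → Bool → Subset N → Subset (suc N)
  cons b S zero    = b
  cons b S (suc i) = S i

  ΣSub : ∀ N → (Subset N → ℕ) → ℕ
  ΣSub N f = Σ[ allSubsets N ] f

  ΣSub-suc : ∀ N (f : Subset (suc N) → ℕ) → Extensional f →
             ΣSub (suc N) f ≡ ΣSub N (λ S → f (cons false S) + f (cons true S))
  ΣSub-suc N f ext = trans (pairs (allSubsets N))
    (Σ-cong (allSubsets N) (λ S → cong₂ _+_ (ext (λ { zero → refl ; (suc i) → refl }))
                                            (ext (λ { zero → refl ; (suc i) → refl }))))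
    where
    pairs : ∀ {A : Set} {g₀ g₁ : A → Subset (suc N)} (xs : List A) →
            Σ[ concatMap (λ a → g₀ a ∷ g₁ a ∷ []) xs ] f ≡ Σ[ xs ] (λ a → f (g₀ a) + f (g₁ a))
    pairs []       = refl
    pairs {g₀ = g₀} {g₁} (x ∷ xs) =
      trans (sym (+-assoc (f (g₀ x)) (f (g₁ x)) _)) (cong (_+_ (f (g₀ x) + f (g₁ x))) (pairs xs))

  cnt : ∀ N → (Subset N → Bool) → Seq
  cnt N P i = ΣSub N (λ S → ind ((size S ≡ᵇ i) ∧ P S))

  size-ext : ∀ {N} → Extensional (size {N})
  size-ext {zero}  e = refl
  size-ext {suc N} e = cong₂ _+_ (cong ind (e zero)) (size-ext (λ i → e (suc i)))

  cnt-split : ∀ N (P : Subset (suc N) → Bool) → Extensional P → ∀ i →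
              cnt (suc N) P i ≡ cnt N (λ S → P (cons false S)) i + shift (cnt N (λ S → P (cons true S))) i
  cnt-split N P ext i =
    trans (ΣSub-suc N _ (λ e → cong₂ (λ s b → ind ((s ≡ᵇ i) ∧ b)) (size-ext e) (ext e)))
          (trans (Σ-+ (allSubsets N) _ _) (cong (_+_ (cnt N (λ S → P (cons false S)) i)) (with-vertex i)))
    where
    with-vertex : ∀ i → ΣSub N (λ S → ind ((suc (size S) ≡ᵇ i) ∧ P (cons true S)))
                        ≡ shift (cnt N (λ S → P (cons true S))) i
    with-vertex zero    = Σ-zero (allSubsets N) _ (λ S → refl)
    with-vertex (suc i) = refl

  cnt-none : ∀ N i → cnt N (λ _ → false) i ≡ 0
  cnt-none N i = Σ-zero (allSubsets N) _ (λ S → cong ind (∧-zeroʳ (size S ≡ᵇ i)))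

  cnt-all : ∀ N i → cnt N (λ _ → true) i ≡ choose N i
  cnt-all zero    zero    = refl
  cnt-all zero    (suc i) = refl
  cnt-all (suc N) i = trans (cnt-split N _ (λ _ → refl) i)
    (cong₂ _+_ (cnt-all N i) (shift-cong (cnt-all N) i))

  cnt-nonempty : ∀ N i → cnt N anyF i ≡ dropConst (choose N) i
  cnt-nonempty zero    zero    = refl
  cnt-nonempty zero    (suc i) = refl
  cnt-nonempty (suc N) i = trans (cnt-split N anyF anyF-cong i) (by-degree i)
    where
    by-degree : ∀ i → cnt N anyF i + shift (cnt N (λ _ → true)) i ≡ dropConst (choose (suc N)) i
    by-degree zero    = trans (+-identityʳ _) (cnt-nonempty N zero)
    by-degree (suc i) = cong₂ _+_ (cnt-nonempty N (suc i)) (cnt-all N i)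

  cnt-full : ∀ N i → cnt N allF i ≡ δ N i
  cnt-full zero    zero    = refl
  cnt-full zero    (suc i) = refl
  cnt-full (suc N) i = trans (cnt-split N allF allF-cong i)
    (cong₂ _+_ (cnt-none N i) (shift-cong (cnt-full N) i))

  atMostOneOut : ∀ {N} → Subset N → Bool
  atMostOneOut {zero}  T = true
  atMostOneOut {suc N} T = if T zero then atMostOneOut (λ i → T (suc i)) else allF (λ i → T (suc i))

  atMostOneOut-ext : ∀ {N} → Extensional (atMostOneOut {N})
  atMostOneOut-ext {zero}  e = refl
  atMostOneOut-ext {suc N} {S} {T} e rewrite e zero with T zero
  ... | true  = atMostOneOut-ext (λ i → e (suc i))
  ... | false = allF-cong (λ i → e (suc i))

  cnt-atMostOneOut : ∀ N i → cnt N atMostOneOut i ≡ δ N i + N * δ N (suc i)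
  cnt-atMostOneOut zero    zero    = refl
  cnt-atMostOneOut zero    (suc i) = refl
  cnt-atMostOneOut (suc N) i =
    trans (cnt-split N atMostOneOut atMostOneOut-ext i) (by-degree i)
    where
    by-degree : ∀ i → cnt N allF i + shift (cnt N atMostOneOut) i ≡ δ (suc N) i + suc N * δ (suc N) (suc i)
    by-degree zero    = trans (+-identityʳ _) (trans (cnt-full N 0) (constant-term N))
      where
      constant-term : ∀ N → δ N 0 ≡ suc N * δ N 0
      constant-term zero    = refl
      constant-term (suc N) = sym (*-zeroʳ (suc (suc N)))
    by-degree (suc i) rewrite cnt-full N (suc i) | cnt-atMostOneOut N i =
      +-exchangeˡ (δ N (suc i)) (δ N i) (N * δ N (suc i))

module ProductRule where

  open BooleanReflection
  open CoefficientSequences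
  open SubsetCounting
  open import Data.Bool using (Bool; true; false; _∧_)
  open import Data.Bool.Properties using (∧-zeroʳ; ∧-identityʳ)
  open import Data.Nat using (ℕ; zero; suc; _+_; _*_; _∸_; _≡ᵇ_; _≤_; _<_; _≤?_; z≤n; s≤s)
  open import Data.Nat.Properties
  open import Data.Fin using (Fin; zero; suc; _↑ˡ_; _↑ʳ_)
  open import Relation.Nullary using (yes; no)
  open import Relation.Binary.PropositionalEquality

  join : ∀ {a b} → Subset a → Subset b → Subset (a + b)
  join {zero}  S₁ S₂ = S₂
  join {suc a} S₁ S₂ = cons (S₁ zero) (join (λ i → S₁ (suc i)) S₂)

  join-extˡ : ∀ {a b} {S₁ S₁' : Subset a} (S₂ : Subset b) → (∀ x → S₁ x ≡ S₁' x) →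
              ∀ x → join S₁ S₂ x ≡ join S₁' S₂ x
  join-extˡ {zero}  S₂ e x       = refl
  join-extˡ {suc a} S₂ e zero    = e zero
  join-extˡ {suc a} S₂ e (suc x) = join-extˡ S₂ (λ i → e (suc i)) x

  join-↑ˡ : ∀ {a b} (S₁ : Subset a) (S₂ : Subset b) (i : Fin a) → join S₁ S₂ (i ↑ˡ b) ≡ S₁ i
  join-↑ˡ S₁ S₂ zero    = refl
  join-↑ˡ S₁ S₂ (suc i) = join-↑ˡ (λ j → S₁ (suc j)) S₂ i

  join-↑ʳ : ∀ {a b} (S₁ : Subset a) (S₂ : Subset b) (i : Fin b) → join S₁ S₂ (a ↑ʳ i) ≡ S₂ i
  join-↑ʳ {zero}  S₁ S₂ i = refl
  join-↑ʳ {suc a} S₁ S₂ i = join-↑ʳ (λ j → S₁ (suc j)) S₂ i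

  size-join : ∀ {a b} (S₁ : Subset a) (S₂ : Subset b) → size (join S₁ S₂) ≡ size S₁ + size S₂
  size-join {zero}  S₁ S₂ = refl
  size-join {suc a} S₁ S₂ = trans (cong (_+_ (ind (S₁ zero))) (size-join (λ i → S₁ (suc i)) S₂))
                                  (sym (+-assoc (ind (S₁ zero)) _ _))

  ΣSub-join : ∀ a b (f : Subset (a + b) → ℕ) → Extensional f →
              ΣSub (a + b) f ≡ ΣSub a (λ S₁ → ΣSub b (λ S₂ → f (join S₁ S₂)))
  ΣSub-join zero    b f ext = sym (+-identityʳ _)
  ΣSub-join (suc a) b f ext = begin
    ΣSub (suc a + b) f
      ≡⟨ ΣSub-suc (a + b) f ext ⟩
    ΣSub (a + b) (λ S → f (cons false S) + f (cons true S))
      ≡⟨ ΣSub-join a b _ (λ e → cong₂ _+_ (ext (cons-ext e)) (ext (cons-ext e))) ⟩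
    ΣSub a (λ S₁ → ΣSub b (λ S₂ → f (cons false (join S₁ S₂)) + f (cons true (join S₁ S₂))))
      ≡⟨ Σ-cong (allSubsets a) (λ S₁ → Σ-+ (allSubsets b) _ _) ⟩
    ΣSub a (λ S₁ → ΣSub b (λ S₂ → f (cons false (join S₁ S₂))) + ΣSub b (λ S₂ → f (cons true (join S₁ S₂))))
      ≡⟨ ΣSub-suc a (λ S₁ → ΣSub b (λ S₂ → f (join S₁ S₂)))
                    (λ e → Σ-cong (allSubsets b) (λ S₂ → ext (join-extˡ S₂ e))) ⟨
    ΣSub (suc a) (λ S₁ → ΣSub b (λ S₂ → f (join S₁ S₂))) ∎
    where
    open ≡-Reasoning
    cons-ext : ∀ {c} {S T : Subset (a + b)} → (∀ x → S x ≡ T x) → ∀ x → cons c S x ≡ cons c T x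
    cons-ext e zero    = refl
    cons-ext e (suc x) = e x

  Σ≤-pick-none : ∀ s i (g : ℕ → ℕ) → i < s → Σ≤ i (λ j → ind (s ≡ᵇ j) * g j) ≡ 0
  Σ≤-pick-none (suc s) zero    g i<s = refl
  Σ≤-pick-none (suc s) (suc i) g i<s
    rewrite Σ≤-pick-none (suc s) i g (<-trans (n<1+n i) i<s)
          | ≡ᵇ-false (suc s) (suc i) (λ e → <-irrefl (sym e) i<s) = refl

  Σ≤-pick : ∀ s i (g : ℕ → ℕ) → s ≤ i → Σ≤ i (λ j → ind (s ≡ᵇ j) * g j) ≡ g s
  Σ≤-pick zero zero g z≤n = +-identityʳ (g 0)
  Σ≤-pick s (suc i) g s≤1+i with s ≤? i
  ... | yes s≤i rewrite Σ≤-pick s i g s≤i | ≡ᵇ-false s (suc i) (λ e → <-irrefl e (s≤s s≤i)) =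
    +-identityʳ (g s)
  ... | no  s≰i with ≤-antisym s≤1+i (≰⇒> s≰i)
  ... | refl rewrite Σ≤-pick-none (suc i) i g (n<1+n i) | ≡ᵇ-true (refl {x = i}) = +-identityʳ (g (suc i))

  ≡ᵇ-cancelˡ : ∀ s t r → (s + t ≡ᵇ s + r) ≡ (t ≡ᵇ r)
  ≡ᵇ-cancelˡ zero    t r = refl
  ≡ᵇ-cancelˡ (suc s) t r = ≡ᵇ-cancelˡ s t r

  offset-count : ∀ b (Q : Subset b → Bool) s i → s ≤ i →
                 ΣSub b (λ S₂ → ind ((s + size S₂ ≡ᵇ i) ∧ Q S₂)) ≡ cnt b Q (i ∸ s)
  offset-count b Q s i s≤i = Σ-cong (allSubsets b) λ S₂ →
    cong (λ c → ind (c ∧ Q S₂))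
         (trans (cong (s + size S₂ ≡ᵇ_) (sym (m+[n∸m]≡n s≤i))) (≡ᵇ-cancelˡ s (size S₂) (i ∸ s)))

  offset-count-none : ∀ b (Q : Subset b → Bool) s i → i < s →
                      ΣSub b (λ S₂ → ind ((s + size S₂ ≡ᵇ i) ∧ Q S₂)) ≡ 0
  offset-count-none b Q s i i<s = Σ-zero (allSubsets b) _ λ S₂ →
    cong (λ c → ind (c ∧ Q S₂)) (≡ᵇ-false _ _ λ e → <⇒≱ i<s (subst (s ≤_) e (m≤m+n s (size S₂))))

  drop-∧true : ∀ b (Q : Subset b → Bool) s i →
               Σ≤ i (λ j → ind ((s ≡ᵇ j) ∧ true) * cnt b Q (i ∸ j)) ≡ Σ≤ i (λ j → ind (s ≡ᵇ j) * cnt b Q (i ∸ j))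
  drop-∧true b Q s i = Σ≤-cong i (λ j → cong (λ c → ind c * cnt b Q (i ∸ j)) (∧-identityʳ (s ≡ᵇ j)))

  fibre : ∀ b (Q : Subset b → Bool) s c i →
          ΣSub b (λ S₂ → ind ((s + size S₂ ≡ᵇ i) ∧ (c ∧ Q S₂)))
            ≡ Σ≤ i (λ j → ind ((s ≡ᵇ j) ∧ c) * cnt b Q (i ∸ j))
  fibre b Q s false i = trans (Σ-zero (allSubsets b) _ (λ S₂ → cong ind (∧-zeroʳ _)))
                             (sym (Σ≤-zero i _ (λ j → cong (λ c → ind c * cnt b Q (i ∸ j)) (∧-zeroʳ (s ≡ᵇ j)))))
  fibre b Q s true i with s ≤? i
  ... | yes s≤i = trans (offset-count b Q s i s≤i) (sym (trans (drop-∧true b Q s i) (Σ≤-pick s i _ s≤i)))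
  ... | no  s≰i = trans (offset-count-none b Q s i (≰⇒> s≰i))
                        (sym (trans (drop-∧true b Q s i) (Σ≤-pick-none s i _ (≰⇒> s≰i))))

  cnt-product : ∀ a b (P : Subset (a + b) → Bool) (P₁ : Subset a → Bool) (P₂ : Subset b → Bool) →
                Extensional P → (∀ S₁ S₂ → P (join S₁ S₂) ≡ P₁ S₁ ∧ P₂ S₂) →
                ∀ i → cnt (a + b) P i ≡ (cnt a P₁ ✶ cnt b P₂) i
  cnt-product a b P P₁ P₂ ext split i = begin
    cnt (a + b) P i
      ≡⟨ ΣSub-join a b _ (λ e → cong₂ (λ s c → ind ((s ≡ᵇ i) ∧ c)) (size-ext e) (ext e)) ⟩
    ΣSub a (λ S₁ → ΣSub b (λ S₂ → ind ((size (join S₁ S₂) ≡ᵇ i) ∧ P (join S₁ S₂))))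
      ≡⟨ Σ-cong (allSubsets a) (λ S₁ → Σ-cong (allSubsets b) (λ S₂ →
           cong₂ (λ s c → ind ((s ≡ᵇ i) ∧ c)) (size-join S₁ S₂) (split S₁ S₂))) ⟩
    ΣSub a (λ S₁ → ΣSub b (λ S₂ → ind ((size S₁ + size S₂ ≡ᵇ i) ∧ (P₁ S₁ ∧ P₂ S₂))))
      ≡⟨ Σ-cong (allSubsets a) (λ S₁ → fibre b P₂ (size S₁) (P₁ S₁) i) ⟩
    ΣSub a (λ S₁ → Σ≤ i (λ j → ind ((size S₁ ≡ᵇ j) ∧ P₁ S₁) * cnt b P₂ (i ∸ j)))
      ≡⟨ Σ≤-Σ (allSubsets a) i _ ⟨
    Σ≤ i (λ j → ΣSub a (λ S₁ → ind ((size S₁ ≡ᵇ j) ∧ P₁ S₁) * cnt b P₂ (i ∸ j)))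
      ≡⟨ Σ≤-cong i (λ j → Σ-*ʳ (allSubsets a) _ (cnt b P₂ (i ∸ j))) ⟨
    (cnt a P₁ ✶ cnt b P₂) i ∎
    where open ≡-Reasoning

module IntegerPolynomials where

  open CoefficientSequences
  open import Data.Nat as ℕ using (ℕ; zero; suc; _∸_; _*_)
  open import Data.Nat.Properties using (+-identityʳ)
  open import Data.Integer as ℤ using (ℤ; +_)
  open import Data.Integer.Properties using (pos-+; pos-*)
  open import Relation.Binary.PropositionalEquality

  poly : Seq → Poly
  poly f i = + f i

  sumTo-cong : ∀ k {h h' : ℕ → ℤ} → (∀ j → h j ≡ h' j) → sumTo k h ≡ sumTo k h'
  sumTo-cong zero    e = e zero
  sumTo-cong (suc k) e = cong₂ ℤ._+_ (sumTo-cong k e) (e (suc k))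

  sumTo-poly : ∀ k (h : ℕ → ℕ) → sumTo k (λ j → + h j) ≡ + Σ≤ k h
  sumTo-poly zero    h = refl
  sumTo-poly (suc k) h = trans (cong (ℤ._+ + h (suc k)) (sumTo-poly k h)) (sym (pos-+ (Σ≤ k h) (h (suc k))))

  ⊕-poly : ∀ {F G} f g → F ≈P poly f → G ≈P poly g → F ⊕ G ≈P poly (λ i → f i ℕ.+ g i)
  ⊕-poly f g eF eG i = trans (cong₂ ℤ._+_ (eF i) (eG i)) (sym (pos-+ (f i) (g i)))

  ⊗-poly : ∀ {F G} f g → F ≈P poly f → G ≈P poly g → F ⊗ G ≈P poly (f ✶ g)
  ⊗-poly f g eF eG k = trans (sumTo-cong k (λ j → trans (cong₂ ℤ._*_ (eF j) (eG (k ∸ j)))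
                                                      (sym (pos-* (f j) (g (k ∸ j))))))
                             (sumTo-poly k (λ j → f j * g (k ∸ j)))

  X+1≈ : X ⊕ const (+ 1) ≈P poly (lin 1 1)
  X+1≈ zero          = refl
  X+1≈ (suc zero)    = refl
  X+1≈ (suc (suc i)) = refl

  X≈ : X ≈P poly (lin 0 1)
  X≈ zero          = refl
  X≈ (suc zero)    = refl
  X≈ (suc (suc i)) = refl

  const≈ : ∀ c → const (+ c) ≈P poly (lin c 0)
  const≈ c zero          = refl
  const≈ c (suc zero)    = refl
  const≈ c (suc (suc i)) = refl

  binomial : ∀ n → (X ⊕ const (+ 1)) ^P n ≈P poly (choose n)
  binomial zero    zero    = refl
  binomial zero    (suc i) = refl
  binomial (suc n) k = trans (⊗-poly (lin 1 1) (choose n) X+1≈ (binomial n) k)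
                             (cong +_ (sym (choose-suc n k)))

  monomial : ∀ n → X ^P n ≈P poly (δ n)
  monomial zero    zero    = refl
  monomial zero    (suc i) = refl
  monomial (suc n) k = trans (⊗-poly (lin 0 1) (δ n) X≈ (monomial n) k) (cong +_ (sym (δ-suc n k)))

  minus-one : ∀ {F} f → F ≈P poly f → f 0 ≡ 1 → F ⊖ const (+ 1) ≈P poly (dropConst f)
  minus-one f eF f0 zero    rewrite eF 0 | f0 = refl
  minus-one f eF f0 (suc i) rewrite eF (suc i) = cong +_ (+-identityʳ (f (suc i)))

  choose-zero : ∀ n → choose n 0 ≡ 1
  choose-zero zero    = refl
  choose-zero (suc n) = trans (+-identityʳ _) (choose-zero n)

  binomial-minus-one : ∀ n → (X ⊕ const (+ 1)) ^P n ⊖ const (+ 1) ≈P poly (dropConst (choose n))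
  binomial-minus-one n = minus-one (choose n) (binomial n) (choose-zero n)

module Propagation where

  open BooleanReflection
  open PowerDomination
  open import Data.Bool using (true; false; _∧_; _∨_; not)
  open import Data.Nat using (ℕ; zero; suc; _+_; _∸_; _≡ᵇ_; _≤_; _<_; _≤?_; z≤n; s≤s)
  open import Data.Nat.Properties
  open import Data.Fin using (Fin; zero; suc; toℕ)
  open import Data.Fin.Properties using (toℕ-injective; toℕ<n; toℕ-fromℕ<; nonZeroIndex)
  open import Data.Nat.DivMod using (_mod_; m<n⇒m%n≡m)
  open import Data.Product using (Σ; _×_; _,_; proj₁; proj₂)
  open import Data.Sum using (_⊎_; inj₁; inj₂)
  open import Data.Empty using (⊥; ⊥-elim)
  open import Relation.Nullary using (yes; no)
  open import Relation.Binary.PropositionalEquality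

  -- If x 0 ∈ S,
  -- consecutive vertices are adjacent, and every neighbour of an inner
  -- vertex x (s+1) is x s, x (s+2) or already dominated, then x t is colored
  -- after t − 1 rounds: each inner vertex forces its successor.
  module ForcingChain {N} (G : Adj N) (S : Subset N) (x : ℕ → Fin N) (L : ℕ)
    (start : S (x 0) ≡ true)
    (edge  : ∀ t → t < L → G (x t) (x (suc t)) ≡ true)
    (tight : ∀ s → suc s < L → ∀ w → G (x (suc s)) w ≡ true →
             w ≡ x (suc (suc s)) ⊎ w ≡ x s ⊎ domStep G S w ≡ true)
    where

    chain-colored : ∀ r t → t ≤ suc r → t ≤ L → round G S r (x t) ≡ true
    chain-colored zero zero          _ _   = domStep-⊇ G S (x 0) start
    chain-colored zero (suc zero)    _ 1≤L = dominated-by G S (x 0) (x 1) start (edge 0 1≤L)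
    chain-colored zero (suc (suc t)) (s≤s ()) _
    chain-colored (suc r) t t≤2+r t≤L with t ≤? suc r
    ... | yes t≤1+r = forceStep-⊇ G (round G S r) (x t) (chain-colored r t t≤1+r t≤L)
    ... | no  t≰1+r with ≤-antisym t≤2+r (≰⇒> t≰1+r)
    ... | refl = forced-by G (round G S r) (x (suc r)) (x t)
                   (chain-colored r (suc r) ≤-refl (≤-trans (n≤1+n (suc r)) t≤L)) (edge (suc r) t≤L) others
      where
      others : ∀ w → (not (G (x (suc r)) w) ∨ (w ==F x t) ∨ round G S r w) ≡ true
      others w with G (x (suc r)) w in g
      ... | false = refl
      ... | true with tight r t≤L w g
      ... | inj₁ refl        = ∨-introˡ _ (==F-refl (x t))
      ... | inj₂ (inj₁ refl) = ∨-introʳ (w ==F x t)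
                                 (chain-colored r r (n≤1+n r) (≤-trans (n≤1+n r) (≤-trans (n≤1+n (suc r)) t≤L)))
      ... | inj₂ (inj₂ d)    = ∨-introʳ (w ==F x t) (round-mono G S {0} {r} z≤n w d)

  Adjacent : ℕ → ℕ → Set
  Adjacent a b = b ≡ suc a ⊎ a ≡ suc b

  adjacent-sym : ∀ {a b} → Adjacent a b → Adjacent b a
  adjacent-sym (inj₁ e) = inj₂ e
  adjacent-sym (inj₂ e) = inj₁ e

  adjacent-two : ∀ {a b c d} → Adjacent a b → Adjacent a c → Adjacent a d → c ≢ d → b ≡ c ⊎ b ≡ d
  adjacent-two (inj₁ refl) (inj₁ refl) _           _   = inj₁ refl
  adjacent-two (inj₁ refl) (inj₂ _)    (inj₁ refl) _   = inj₂ refl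
  adjacent-two (inj₁ refl) (inj₂ ac)   (inj₂ ad)   c≢d = ⊥-elim (c≢d (suc-injective (trans (sym ac) ad)))
  adjacent-two (inj₂ ab)   (inj₂ ac)   _           _   = inj₁ (suc-injective (trans (sym ab) ac))
  adjacent-two (inj₂ ab)   (inj₁ _)    (inj₂ ad)   _   = inj₂ (suc-injective (trans (sym ab) ad))
  adjacent-two (inj₂ _)    (inj₁ refl) (inj₁ refl) c≢d = ⊥-elim (c≢d refl)

  inner-position : ∀ {a c d m} → Adjacent a c → Adjacent a d → c ≢ d → c < m → d < m → 0 < a × suc a < m
  inner-position (inj₁ refl) (inj₁ refl) c≢d _   _   = ⊥-elim (c≢d refl)
  inner-position (inj₁ refl) (inj₂ refl) _   c<m _   = s≤s z≤n , c<m
  inner-position (inj₂ refl) (inj₁ refl) _   _   d<m = s≤s z≤n , d<m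
  inner-position (inj₂ ac)   (inj₂ ad)   c≢d _   _   = ⊥-elim (c≢d (suc-injective (trans (sym ac) ad)))

  path-intro : ∀ {m} (u v : Fin m) → Adjacent (toℕ u) (toℕ v) → path m u v ≡ true
  path-intro u v (inj₁ e) = ∨-introˡ _ (≡ᵇ-true e)
  path-intro u v (inj₂ e) = ∨-introʳ (toℕ v ≡ᵇ suc (toℕ u)) (≡ᵇ-true e)

  cycle-inner : ∀ {m} (u v : Fin m) → cycle m u v ≡ true → 0 < toℕ u → suc (toℕ u) < m →
                Adjacent (toℕ u) (toℕ v)
  cycle-inner {m} u v e 0<u u+1<m with ∨-elim (path m u v) _ e
  ... | inj₁ p with ∨-elim (toℕ v ≡ᵇ suc (toℕ u)) _ p
  ...   | inj₁ q = inj₁ (≡ᵇ-sound _ _ q)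
  ...   | inj₂ q = inj₂ (≡ᵇ-sound _ _ q)
  cycle-inner {m} u v e 0<u u+1<m | inj₂ wrap with ∨-elim ((toℕ u ≡ᵇ 0) ∧ (toℕ v ≡ᵇ m ∸ 1)) _ wrap
  ... | inj₁ q = ⊥-elim (<⇒≢ 0<u (sym (≡ᵇ-sound _ _ (∧-elimˡ _ _ q))))
  ... | inj₂ q = ⊥-elim (not-last m (≡ᵇ-sound _ _ (∧-elimʳ _ _ q)) u+1<m)
    where
    not-last : ∀ m {a} → a ≡ m ∸ 1 → suc a < m → ⊥
    not-last (suc m) refl m+1<m+1 = <-irrefl refl m+1<m+1

  -- G contains the cycle 0, …, m − 1 through e, except possibly for the
  -- closing edge, and each vertex e u has no neighbours besides its cycle
  -- neighbours and vertices of B.  (Paths, cycles and wheels are of this form.)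
  record CycleLike {N} (G : Adj N) (m : ℕ) (e : Fin m → Fin N) (B : Subset N) : Set where
    field
      path-edge  : ∀ u v → path m u v ≡ true → G (e u) (e v) ≡ true
      neighbours : ∀ u w → G (e u) w ≡ true → B w ≡ true ⊎ Σ (Fin m) (λ v → w ≡ e v × cycle m u v ≡ true)

  module Sweep {N m} {G : Adj N} {e : Fin m → Fin N} {B : Subset N} (cyc : CycleLike G m e B)
    (S : Subset N) (B-dominated : B ⊆ domStep G S) (p : ℕ → Fin m) (L : ℕ)
    (start   : S (e (p 0)) ≡ true)
    (step    : ∀ t → t < L → Adjacent (toℕ (p t)) (toℕ (p (suc t))))
    (no-turn : ∀ s → suc s < L → toℕ (p s) ≢ toℕ (p (suc (suc s))))
    where
    open CycleLike cyc

    tight : ∀ s → suc s < L → ∀ w → G (e (p (suc s))) w ≡ true →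
            w ≡ e (p (suc (suc s))) ⊎ w ≡ e (p s) ⊎ domStep G S w ≡ true
    tight s s+1<L w g with neighbours (p (suc s)) w g
    ... | inj₁ Bw = inj₂ (inj₂ (B-dominated w Bw))
    ... | inj₂ (v , refl , vu) = on-cycle (adjacent-two (cycle-inner (p (suc s)) v vu 0<a a+1<m) before after distinct)
      where
      before   = adjacent-sym (step s (<-trans (n<1+n s) s+1<L))
      after    = step (suc s) s+1<L
      distinct = no-turn s s+1<L
      inner    = inner-position before after distinct (toℕ<n (p s)) (toℕ<n (p (suc (suc s))))
      0<a      = proj₁ inner
      a+1<m    = proj₂ inner
      on-cycle : toℕ v ≡ toℕ (p s) ⊎ toℕ v ≡ toℕ (p (suc (suc s))) →
                 e v ≡ e (p (suc (suc s))) ⊎ e v ≡ e (p s) ⊎ domStep G S (e v) ≡ true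
      on-cycle (inj₁ v≡ps)  = inj₂ (inj₁ (cong e (toℕ-injective v≡ps)))
      on-cycle (inj₂ v≡ps2) = inj₁ (cong e (toℕ-injective v≡ps2))

    sweep-colored : ∀ r t → t ≤ suc r → t ≤ L → round G S r (e (p t)) ≡ true
    sweep-colored = ForcingChain.chain-colored G S (λ t → e (p t)) L start
      (λ t t<L → path-edge (p t) (p (suc t)) (path-intro (p t) (p (suc t)) (step t t<L))) tight

  two-apart : ∀ {a b} → b ≡ suc (suc a) → a ≢ b
  two-apart {a} b≡a+2 a≡b = <-irrefl (trans a≡b b≡a+2) (m<n⇒m<1+n (n<1+n a))

  down-step : ∀ {o t} → t < o → o ∸ t ≡ suc (o ∸ suc t)
  down-step {suc o} (s≤s t≤o) = +-∸-assoc 1 t≤o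

  module Walks {N m} {G : Adj N} {e : Fin m → Fin N} {B : Subset N} (cyc : CycleLike G m e B) (m≤N : m ≤ N)
    (S : Subset N) (B-dominated : B ⊆ domStep G S) (j : Fin m) (Sj : S (e j) ≡ true) where

    instance _ = nonZeroIndex j

    -- the vertex at position k (meaningful for k < m)
    at : ℕ → Fin m
    at k = k mod m

    at-toℕ : ∀ {k} (v : Fin m) → toℕ v ≡ k → at k ≡ v
    at-toℕ v refl = toℕ-injective (trans (toℕ-fromℕ< _) (m<n⇒m%n≡m (toℕ<n v)))

    toℕ-at : ∀ {k} → k < m → toℕ (at k) ≡ k
    toℕ-at k<m = trans (toℕ-fromℕ< _) (m<n⇒m%n≡m k<m)

    walk-observed : ∀ (p : ℕ → ℕ) L → (∀ t → t ≤ L → p t < m) → p 0 ≡ toℕ j →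
                    (∀ t → t < L → Adjacent (p t) (p (suc t))) → (∀ s → suc s < L → p s ≢ p (suc (suc s))) →
                    L < m → observed G S (e (at (p L))) ≡ true
    walk-observed p L p<m p0 step no-turn L<m =
      round⊆observed G S {N} ≤-refl _
        (Sweep.sweep-colored cyc S B-dominated (λ t → at (p t)) L
           (subst (λ v → S (e v) ≡ true) (sym (at-toℕ j (sym p0))) Sj)
           (λ t t<L → subst₂ Adjacent (sym (toℕ-at (p<m t (<⇒≤ t<L)))) (sym (toℕ-at (p<m (suc t) t<L))) (step t t<L))
           (λ s s+1<L → subst₂ _≢_ (sym (toℕ-at (p<m s (<⇒≤ (<-trans (n<1+n s) s+1<L)))))
                                   (sym (toℕ-at (p<m (suc (suc s)) s+1<L))) (no-turn s s+1<L))
           N L (≤-trans (<⇒≤ (<-≤-trans L<m m≤N)) (n≤1+n N)) ≤-refl)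

    observed-above : ∀ v → toℕ j ≤ toℕ v → observed G S (e v) ≡ true
    observed-above v j≤v = subst (λ u → observed G S (e u) ≡ true) (at-toℕ v (sym (m+[n∸m]≡n j≤v)))
      (walk-observed (_+_ (toℕ j)) (toℕ v ∸ toℕ j) bound (+-identityʳ (toℕ j)) (λ t _ → inj₁ (+-suc (toℕ j) t))
                     (λ s _ → two-apart (trans (+-suc (toℕ j) (suc s)) (cong suc (+-suc (toℕ j) s))))
                     (≤-<-trans (m∸n≤m (toℕ v) (toℕ j)) (toℕ<n v)))
      where
      bound : ∀ t → t ≤ toℕ v ∸ toℕ j → toℕ j + t < m
      bound t t≤L = ≤-<-trans (+-monoʳ-≤ (toℕ j) t≤L) (subst (_< m) (sym (m+[n∸m]≡n j≤v)) (toℕ<n v))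

    observed-below : ∀ v → toℕ v < toℕ j → observed G S (e v) ≡ true
    observed-below v v<j = subst (λ u → observed G S (e u) ≡ true) (at-toℕ v (sym (m∸[m∸n]≡n (<⇒≤ v<j))))
      (walk-observed (toℕ j ∸_) L (λ t _ → ≤-<-trans (m∸n≤m (toℕ j) t) (toℕ<n j)) refl
                     (λ t t<L → inj₂ (down-step (below t t<L)))
                     (λ s s+1<L → ≢-sym (two-apart (trans (down-step (below s (<-trans (n<1+n s) s+1<L)))
                                                         (cong suc (down-step (below (suc s) s+1<L))))))
                     (≤-<-trans (m∸n≤m (toℕ j) (toℕ v)) (toℕ<n j)))
      where
      L = toℕ j ∸ toℕ v
      below : ∀ t → t < L → t < toℕ j
      below t t<L = <-≤-trans t<L (m∸n≤m (toℕ j) (toℕ v))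

  cycleLike-PDS : ∀ {N m} {G : Adj N} {e : Fin m → Fin N} {B : Subset N} → CycleLike G m e B → m ≤ N →
                  (∀ x → B x ≡ true ⊎ Σ (Fin m) (λ v → x ≡ e v)) →
                  ∀ S → B ⊆ domStep G S → ∀ j → S (e j) ≡ true → isPDS G S ≡ true
  cycleLike-PDS {G = G} cyc m≤N cover S B-dominated j Sj = PDS-intro G S observe
    where
    open Walks cyc m≤N S B-dominated j Sj
    observe : ∀ x → observed G S x ≡ true
    observe x with cover x
    ... | inj₁ Bx = round⊆observed G S {0} z≤n x (B-dominated x Bx)
    ... | inj₂ (v , refl) with toℕ j ≤? toℕ v
    ... | yes j≤v = observed-above v j≤v
    ... | no  j≰v = observed-below v (≰⇒> j≰v)

module GraphFamilies where

  open BooleanReflection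
  open PowerDomination
  open SubsetCounting
  open Propagation
  open import Data.Bool using (Bool; true; false; _∨_; not)
  open import Data.Nat using (ℕ; zero; suc; z≤n; s≤s)
  open import Data.Nat.Properties using (≤-refl; n≤1+n)
  open import Data.Fin as Fin using (Fin; zero; suc)
  open import Data.Fin.Properties using (suc-injective)
  open import Data.Product using (Σ; ∃; _×_; _,_; proj₁; proj₂)
  open import Data.Sum using (_⊎_; inj₁; inj₂)
  open import Data.Empty using (⊥-elim)
  open import Relation.Nullary using (yes; no)
  open import Relation.Binary.PropositionalEquality

  PDS≡nonempty : ∀ {n} (G : Adj (suc n)) → (∀ S j → S j ≡ true → isPDS G S ≡ true) →
                 ∀ S → isPDS G S ≡ anyF S
  PDS≡nonempty G every S with anyF S in nonempty
  ... | true  = let (j , Sj) = anyF-elim S nonempty in every S j Sj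
  ... | false = empty-not-PDS G S nonempty

  -- Complete graphs: any vertex dominates everything.
  complete-PDS : ∀ n S j → S j ≡ true → isPDS (complete (suc n)) S ≡ true
  complete-PDS n S j Sj = dominating⇒PDS G S dominated
    where
    G = complete (suc n)
    dominated : ∀ x → domStep G S x ≡ true
    dominated x with j Fin.≟ x
    ... | yes refl = domStep-⊇ G S j Sj
    ... | no  j≢x  = dominated-by G S j x Sj (not-intro (==F-false j x j≢x))

  nothing : ∀ {n} → Subset n
  nothing _ = false

  path⊆cycle : ∀ {m} (u v : Fin m) → path m u v ≡ true → cycle m u v ≡ true
  path⊆cycle u v e = ∨-introˡ _ e

  path-cycleLike : ∀ n → CycleLike (path n) n (λ v → v) nothing
  path-cycleLike n = record
    { path-edge  = λ u v e → e
    ; neighbours = λ u w e → inj₂ (w , refl , path⊆cycle u w e) }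

  cycle-cycleLike : ∀ n → CycleLike (cycle n) n (λ v → v) nothing
  cycle-cycleLike n = record
    { path-edge  = path⊆cycle
    ; neighbours = λ u w e → inj₂ (w , refl , e) }

  path-PDS : ∀ n S j → S j ≡ true → isPDS (path n) S ≡ true
  path-PDS n S = cycleLike-PDS (path-cycleLike n) ≤-refl (λ x → inj₂ (x , refl)) S (λ x ())

  cycle-PDS : ∀ n S j → S j ≡ true → isPDS (cycle n) S ≡ true
  cycle-PDS n S = cycleLike-PDS (cycle-cycleLike n) ≤-refl (λ x → inj₂ (x , refl)) S (λ x ())

  -- Wheels: the rim is cycle-like with the hub outside.  A set containing the
  -- hub is dominating; a set containing a rim vertex dominates the hub.

  hub : ∀ {m} → Subset (suc m)
  hub zero    = true
  hub (suc _) = false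

  wheel-cycleLike : ∀ m → CycleLike (wheel (suc m)) m suc hub
  wheel-cycleLike m = record
    { path-edge  = λ u v e → path⊆cycle u v e
    ; neighbours = neighbours }
    where
    neighbours : ∀ u w → wheel (suc m) (suc u) w ≡ true →
                 hub w ≡ true ⊎ Σ (Fin m) (λ v → w ≡ suc v × cycle m u v ≡ true)
    neighbours u zero    e = inj₁ refl
    neighbours u (suc w) e = inj₂ (w , refl , e)

  wheel-PDS : ∀ m S j → S j ≡ true → isPDS (wheel (suc m)) S ≡ true
  wheel-PDS m S zero Sj = dominating⇒PDS G S dominated
    where
    G = wheel (suc m)
    dominated : ∀ x → domStep G S x ≡ true
    dominated zero    = domStep-⊇ G S zero Sj
    dominated (suc i) = dominated-by G S zero (suc i) Sj refl
  wheel-PDS m S (suc j) Sj = cycleLike-PDS (wheel-cycleLike m) (n≤1+n m) rim-or-hub S hub-dominated j Sj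
    where
    rim-or-hub : ∀ x → hub x ≡ true ⊎ Σ (Fin m) (λ v → x ≡ suc v)
    rim-or-hub zero    = inj₁ refl
    rim-or-hub (suc v) = inj₂ (v , refl)
    hub-dominated : hub ⊆ domStep (wheel (suc m)) S
    hub-dominated zero _ = dominated-by (wheel (suc m)) S (suc j) zero Sj refl

  -- Edgeless graphs: nothing is ever dominated or forced, so only the full set works.
  edgeless-PDS : ∀ n S → isPDS (edgeless n) S ≡ allF S
  edgeless-PDS n S with allF S in full
  ... | true  = dominating⇒PDS (edgeless n) S (λ x → domStep-⊇ (edgeless n) S x (allF-elim S full x))
  ... | false = let (x , Sx) = allF-false-elim S full in PDS-refute (edgeless n) S S x no-domination no-forcing Sx
    where
    no-domination : domStep (edgeless n) S ⊆ S
    no-domination x h with dominated-elim (edgeless n) S x h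
    ... | inj₁ Sx      = Sx
    ... | inj₂ (u , q) = ⊥-elim (true≢false (sym (∧-elimʳ (S u) false q)))
    no-forcing : forceStep (edgeless n) S ⊆ S
    no-forcing x h with forced-elim (edgeless n) S x h
    ... | inj₁ Sx                 = Sx
    ... | inj₂ (u , _ , () , _)

  starPDS : ∀ {m} → Subset (suc m) → Bool
  starPDS S = S zero ∨ atMostOneOut (λ i → S (suc i))

  atMostOneOut-only : ∀ {N} (T : Subset N) → atMostOneOut T ≡ true → ∀ v → T v ≡ false → ∀ w → w ≢ v → T w ≡ true
  atMostOneOut-only {suc N} T a v Tv w w≢v with T zero in T0
  atMostOneOut-only {suc N} T a zero    Tv w       w≢v | true  = ⊥-elim (true≢false (trans (sym T0) Tv))
  atMostOneOut-only {suc N} T a (suc v) Tv zero    w≢v | true  = T0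
  atMostOneOut-only {suc N} T a (suc v) Tv (suc w) w≢v | true  =
    atMostOneOut-only (λ i → T (suc i)) a v Tv w (λ e → w≢v (cong suc e))
  atMostOneOut-only {suc N} T a zero    Tv zero    w≢v | false = ⊥-elim (w≢v refl)
  atMostOneOut-only {suc N} T a zero    Tv (suc w) w≢v | false = allF-elim (λ i → T (suc i)) a w
  atMostOneOut-only {suc N} T a (suc v) Tv w       w≢v | false =
    ⊥-elim (true≢false (trans (sym (allF-elim (λ i → T (suc i)) a v)) Tv))

  atMostOneOut-some : ∀ {N} (T : Subset (suc (suc N))) → atMostOneOut T ≡ true → ∃ λ l → T l ≡ true
  atMostOneOut-some T a with T zero in T0
  ... | true  = zero , T0
  ... | false = suc zero , allF-elim (λ i → T (suc i)) a zero

  atMostOneOut-two : ∀ {N} (T : Subset N) → atMostOneOut T ≡ false →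
                     Σ (Fin N) λ a → Σ (Fin N) λ b → a ≢ b × T a ≡ false × T b ≡ false
  atMostOneOut-two {suc N} T a with T zero in T0
  ... | true  = let (x , y , x≢y , Tx , Ty) = atMostOneOut-two (λ i → T (suc i)) a
                in suc x , suc y , (λ e → x≢y (suc-injective e)) , Tx , Ty
  ... | false = let (i , Ti) = allF-false-elim (λ i → T (suc i)) a in zero , suc i , (λ ()) , T0 , Ti

  module Star (m : ℕ) (S : Subset (suc (suc (suc m)))) where
    G : Adj (suc (suc (suc m)))
    G = star (suc (suc (suc m)))

    leaves : Subset (suc (suc m))
    leaves i = S (suc i)

    with-center : S zero ≡ true → isPDS G S ≡ true
    with-center S0 = dominating⇒PDS G S dominated
      where
      dominated : ∀ x → domStep G S x ≡ true
      dominated zero    = domStep-⊇ G S zero S0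
      dominated (suc i) = dominated-by G S zero (suc i) S0 refl

    -- A leaf in S dominates the center, which then forces the missing leaf.
    one-leaf-out : atMostOneOut leaves ≡ true → isPDS G S ≡ true
    one-leaf-out a = PDS-intro G S (λ x → round⊆observed G S {1} (s≤s z≤n) x (after-one-round x))
      where
      D = domStep G S
      leaf-in-S = atMostOneOut-some leaves a
      center : D zero ≡ true
      center = dominated-by G S (suc (proj₁ leaf-in-S)) zero (proj₂ leaf-in-S) refl
      leaf : ∀ v b → leaves v ≡ b → forceStep G D (suc v) ≡ true
      leaf v true  Sv = forceStep-⊇ G D (suc v) (domStep-⊇ G S (suc v) Sv)
      leaf v false Sv = forced-by G D zero (suc v) center refl others
        where
        others : ∀ w → (not (G zero w) ∨ (w ==F suc v) ∨ D w) ≡ true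
        others zero = refl
        others (suc w) with w Fin.≟ v
        ... | yes refl = refl
        ... | no  w≢v  = domStep-⊇ G S (suc w) (atMostOneOut-only leaves a v Sv w w≢v)
      after-one-round : ∀ x → forceStep G D x ≡ true
      after-one-round zero    = forceStep-⊇ G D zero center
      after-one-round (suc v) = leaf v (leaves v) refl

    -- Without the center and with two leaves missing, the coloring
    -- "center and the leaves of S" is closed: the center never forces.
    two-leaves-out : S zero ≡ false → atMostOneOut leaves ≡ false → isPDS G S ≡ false
    two-leaves-out S0 a with atMostOneOut-two leaves a
    ... | (a₁ , a₂ , a₁≢a₂ , Sa₁ , Sa₂) = PDS-refute G S D (suc a₁) dominated-in closed Sa₁
      where
      D : Subset (suc (suc (suc m)))
      D = cons true leaves
      dominated-in : domStep G S ⊆ D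
      dominated-in zero    h = refl
      dominated-in (suc i) h with dominated-elim G S (suc i) h
      ... | inj₁ Si           = Si
      ... | inj₂ (zero , q)   = ⊥-elim (true≢false (trans (sym (∧-elimˡ (S zero) _ q)) S0))
      ... | inj₂ (suc u , q)  = ⊥-elim (true≢false (sym (∧-elimʳ (S (suc u)) false q)))
      -- another missing leaf w ≠ v, which prevents the center from forcing v
      other-missing : ∀ v → Σ (Fin (suc (suc m))) λ w → w ≢ v × leaves w ≡ false
      other-missing v with a₁ Fin.≟ v
      ... | yes refl = a₂ , (λ e → a₁≢a₂ (sym e)) , Sa₂
      ... | no  a₁≢v = a₁ , a₁≢v , Sa₁
      closed-leaf : ∀ v b → leaves v ≡ b → forceStep G D (suc v) ≡ true → D (suc v) ≡ true
      closed-leaf v true  Sv h = Sv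
      closed-leaf v false Sv h with forced-elim G D (suc v) h
      ... | inj₁ Dv                       = Dv
      ... | inj₂ (suc u , _ , () , _)
      ... | inj₂ (zero , _ , _ , others) with other-missing v
      ... | (w , w≢v , Sw) = ⊥-elim (true≢false (trans (sym (others (suc w)))
                               (∨-false (==F-false (suc w) (suc v) (λ e → w≢v (suc-injective e))) Sw)))
      closed : forceStep G D ⊆ D
      closed zero    h = refl
      closed (suc v) h = closed-leaf v (leaves v) refl h

  star-PDS : ∀ m S → isPDS (star (suc (suc (suc m)))) S ≡ starPDS S
  star-PDS m S = classify (S zero) (atMostOneOut leaves) refl refl
    where
    open Star m S
    classify : ∀ c a → S zero ≡ c → atMostOneOut leaves ≡ a → isPDS G S ≡ starPDS S
    classify true  _     S0 _ = trans (with-center S0) (sym (cong (_∨ atMostOneOut leaves) S0))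
    classify false true  S0 a = trans (one-leaf-out a) (sym (cong₂ _∨_ S0 a))
    classify false false S0 a = trans (two-leaves-out S0 a) (sym (cong₂ _∨_ S0 a))

module Coronas where

  open BooleanReflection
  open PowerDomination
  open SubsetCounting
  open ProductRule
  open import Data.Bool using (Bool; true; false; _∧_; _∨_; not)
  open import Data.Nat using (ℕ; zero; suc; _*_)
  open import Data.Fin as Fin using (Fin; zero; suc; _↑ˡ_; _↑ʳ_; combine; remQuot)
  open import Data.Fin.Properties using (remQuot-combine; combine-remQuot; combine-injectiveʳ; suc-injective)
  open import Data.Product using (∃; _×_; _,_; proj₁; proj₂; uncurry)
  open import Data.Sum using (inj₁; inj₂)
  open import Data.Empty using (⊥; ⊥-elim)
  open import Relation.Nullary using (yes; no)
  open import Relation.Binary.PropositionalEquality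

  blocksHit : ∀ n k → Subset (n * suc k) → Bool
  blocksHit zero    k S = true
  blocksHit (suc n) k S = anyF (λ a → S (a ↑ˡ (n * suc k))) ∧ blocksHit n k (λ x → S (suc k ↑ʳ x))

  blocksHit-ext : ∀ n k → Extensional (blocksHit n k)
  blocksHit-ext zero    k e = refl
  blocksHit-ext (suc n) k e = cong₂ _∧_ (anyF-cong (λ a → e (a ↑ˡ (n * suc k))))
                                        (blocksHit-ext n k (λ x → e (suc k ↑ʳ x)))

  blocksHit-join : ∀ n k (S₁ : Subset (suc k)) (S₂ : Subset (n * suc k)) →
                   blocksHit (suc n) k (join S₁ S₂) ≡ anyF S₁ ∧ blocksHit n k S₂
  blocksHit-join n k S₁ S₂ = cong₂ _∧_ (anyF-cong (join-↑ˡ S₁ S₂)) (blocksHit-ext n k (join-↑ʳ S₁ S₂))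

  blocksHit-elim : ∀ n k (S : Subset (n * suc k)) → blocksHit n k S ≡ true →
                   ∀ i → ∃ λ a → S (combine {n} {suc k} i a) ≡ true
  blocksHit-elim (suc n) k S h zero    = anyF-elim _ (∧-elimˡ _ _ h)
  blocksHit-elim (suc n) k S h (suc i) =
    blocksHit-elim n k (λ x → S (suc k ↑ʳ x)) (∧-elimʳ (anyF (λ a → S (a ↑ˡ (n * suc k)))) _ h) i

  blocksHit-missed : ∀ n k (S : Subset (n * suc k)) → blocksHit n k S ≡ false →
                     ∃ λ i → ∀ a → S (combine {n} {suc k} i a) ≡ false
  blocksHit-missed (suc n) k S h with anyF (λ a → S (a ↑ˡ (n * suc k))) in first
  ... | false = zero , anyF-false-elim _ first
  ... | true  = let (i , missed) = blocksHit-missed n k (λ x → S (suc k ↑ʳ x)) h in suc i , missed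

  module CoronaGraph {n : ℕ} (H : Adj n) (k : ℕ) where
    G : Adj (n * suc k)
    G = corona H k

    vertex : Fin n → Fin (suc k) → Fin (n * suc k)
    vertex = combine

    by-vertex : (P : Fin (n * suc k) → Set) → (∀ i a → P (vertex i a)) → ∀ x → P x
    by-vertex P h x = subst P (combine-remQuot {n} (suc k) x)
                        (h (proj₁ (remQuot {n} (suc k) x)) (proj₂ (remQuot {n} (suc k) x)))

    block-clique : ∀ i (a b : Fin (suc k)) → a ≢ b → G (vertex i a) (vertex i b) ≡ true
    block-clique i zero    zero    a≢b = ⊥-elim (a≢b refl)
    block-clique i zero    (suc b) _   rewrite remQuot-combine {n} {suc k} i zero
                                             | remQuot-combine {n} {suc k} i (suc b) = ==F-refl i
    block-clique i (suc a) zero    _   rewrite remQuot-combine {n} {suc k} i (suc a)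
                                             | remQuot-combine {n} {suc k} i zero = ==F-refl i
    block-clique i (suc a) (suc b) a≢b rewrite remQuot-combine {n} {suc k} i (suc a)
                                             | remQuot-combine {n} {suc k} i (suc b) | ==F-refl i =
      not-intro (==F-false a b (λ e → a≢b (cong suc e)))

    same-block : ∀ {u j b} → remQuot (suc k) u ≡ (j , b) → ∀ i a → G u (vertex i (suc a)) ≡ true → j ≡ i
    same-block {u} {j} {zero}  e i a h = ==F-sound j i (trans (sym value) h)
      where
      value : G u (vertex i (suc a)) ≡ (j ==F i)
      value rewrite e | remQuot-combine {n} {suc k} i (suc a) = refl
    same-block {u} {j} {suc b} e i a h = ==F-sound j i (∧-elimˡ _ _ (trans (sym value) h))
      where
      value : G u (vertex i (suc a)) ≡ (j ==F i) ∧ not (b ==F a)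
      value rewrite e | remQuot-combine {n} {suc k} i (suc a) = refl

    copy-neighbour : ∀ u i (a : Fin k) → G u (vertex i (suc a)) ≡ true → ∃ λ b → u ≡ vertex i b
    copy-neighbour u i a h with remQuot (suc k) u in e
    ... | (j , b) = b , trans (sym decomposed) (cong (λ z → vertex z b) (same-block e i a h))
      where
      decomposed : vertex j b ≡ u
      decomposed = trans (cong (uncurry (combine {n} {suc k})) (sym e)) (combine-remQuot {n} (suc k) u)

    -- If S meets every block, S is dominating, since blocks are cliques.
    all-blocks-hit : ∀ S → blocksHit n k S ≡ true → isPDS G S ≡ true
    all-blocks-hit S hit = dominating⇒PDS G S (by-vertex (λ x → domStep G S x ≡ true) dominated)
      where
      dominated : ∀ i a → domStep G S (vertex i a) ≡ true
      dominated i a with blocksHit-elim n k S hit i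
      ... | a' , Sa' with a' Fin.≟ a
      ... | yes refl = domStep-⊇ G S (vertex i a') Sa'
      ... | no  a'≢a = dominated-by G S (vertex i a') (vertex i a) Sa' (block-clique i a' a a'≢a)

    -- If S misses block i and k ≥ 2, then "everything except the copy of K_k
    -- in block i" is closed: the copy is not dominated, and the only colored
    -- neighbour of a copy vertex, vertex i of H, has at least two uncolored
    -- neighbours in the copy.
    module MissedBlock (another : ∀ (a : Fin k) → ∃ λ c → c ≢ a)
                       (S : Subset (n * suc k)) (i : Fin n) (missed : ∀ a → S (vertex i a) ≡ false) where

      outside : Fin n × Fin (suc k) → Bool
      outside (j , zero)  = true
      outside (j , suc a) = not (j ==F i)

      D : Subset (n * suc k)
      D x = outside (remQuot (suc k) x)

      D-vertex : ∀ j a → D (vertex j a) ≡ outside (j , a)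
      D-vertex j a = cong outside (remQuot-combine {n} {suc k} j a)

      D-copy : ∀ a → D (vertex i (suc a)) ≡ false
      D-copy a = trans (D-vertex i (suc a)) (cong not (==F-refl i))

      not-in-S : ∀ {u} → S u ≡ true → ∀ a → u ≡ vertex i a → ⊥
      not-in-S Su a refl = true≢false (trans (sym Su) (missed a))

      dominated-in : domStep G S ⊆ D
      dominated-in = by-vertex (λ x → domStep G S x ≡ true → D x ≡ true) λ j a h → trans (D-vertex j a) (in-block j a h)
        where
        in-block : ∀ j a → domStep G S (vertex j a) ≡ true → outside (j , a) ≡ true
        in-block j zero    h = refl
        in-block j (suc a) h with j Fin.≟ i
        ... | no  _    = refl
        ... | yes refl with dominated-elim G S (vertex j (suc a)) h
        ... | inj₁ Sv       = ⊥-elim (not-in-S Sv (suc a) refl)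
        ... | inj₂ (u , q) with copy-neighbour u j a (∧-elimʳ (S u) _ q)
        ... | b , u≡ = ⊥-elim (not-in-S (∧-elimˡ (S u) _ q) b u≡)

      closed : forceStep G D ⊆ D
      closed = by-vertex (λ x → forceStep G D x ≡ true → D x ≡ true) λ j a h → trans (D-vertex j a) (in-block j a h)
        where
        in-block : ∀ j a → forceStep G D (vertex j a) ≡ true → outside (j , a) ≡ true
        in-block j zero    h = refl
        in-block j (suc a) h with j Fin.≟ i
        ... | no  _    = refl
        ... | yes refl with forced-elim G D (vertex j (suc a)) h
        ... | inj₁ Dv = ⊥-elim (true≢false (trans (sym Dv) (D-copy a)))
        ... | inj₂ (u , Du , guv , others) with copy-neighbour u j a guv
        ... | suc b , refl = ⊥-elim (true≢false (trans (sym Du) (D-copy b)))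
        ... | zero  , refl = ⊥-elim (true≢false (trans (sym (others w)) blocked))
          where
          c = proj₁ (another a)
          w = vertex j (suc c)
          blocked : (not (G (vertex j zero) w) ∨ (w ==F vertex j (suc a)) ∨ D w) ≡ false
          blocked = ∨-false (cong not (block-clique j zero (suc c) (λ ())))
                     (∨-false (==F-false w (vertex j (suc a))
                                (λ e → proj₂ (another a) (suc-injective (combine-injectiveʳ j (suc c) j (suc a) e))))
                              (D-copy c))

      not-PDS : Fin k → isPDS G S ≡ false
      not-PDS a = PDS-refute G S D (vertex i (suc a)) dominated-in closed (D-copy a)

  corona-PDS : ∀ {n} (H : Adj n) k (S : Subset (n * suc (suc (suc k)))) →
               isPDS (corona H (suc (suc k))) S ≡ blocksHit n (suc (suc k)) S
  corona-PDS {n} H k S with blocksHit n (suc (suc k)) S in hit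
  ... | true  = CoronaGraph.all-blocks-hit H (suc (suc k)) S hit
  ... | false = let (i , missed) = blocksHit-missed n (suc (suc k)) S hit
                in CoronaGraph.MissedBlock.not-PDS H (suc (suc k)) another S i missed zero
    where
    another : ∀ (a : Fin (suc (suc k))) → ∃ λ c → c ≢ a
    another zero    = suc zero , (λ ())
    another (suc _) = zero , (λ ())

module DominationPolynomials where

  open BooleanReflection
  open CoefficientSequences
  open SubsetCounting
  open ProductRule
  open IntegerPolynomials
  open GraphFamilies
  open Coronas
  open import Data.Bool using (Bool; _∧_; _∨_)
  open import Data.Bool.Properties using (∧-comm)
  open import Data.Nat using (ℕ; zero; suc; _+_; _*_; _∸_; _≤_; _<_; _≡ᵇ_; s≤s)
  import Data.Fin as Fin
  open import Data.Nat.Properties using (+-comm; *-zeroʳ)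
  open import Data.Nat.Tactic.RingSolver using (solve-∀)
  open import Data.Integer using (+_)
  open import Data.Product using (_×_; _,_)
  open import Relation.Binary.PropositionalEquality

  PDP-count : ∀ {N} (G : Adj N) (P : Subset N → Bool) → (∀ S → isPDS G S ≡ P S) →
              PDP G ≈P poly (dropConst (cnt N P))
  PDP-count {N} G P char zero    = refl
  PDP-count {N} G P char (suc i) = cong +_ (Σ-cong (allSubsets N) λ S →
    cong ind (trans (cong (_∧ (size S ≡ᵇ suc i)) (char S)) (∧-comm (P S) (size S ≡ᵇ suc i))))

  PDP-nonempty : ∀ {N} (G : Adj N) → (∀ S → isPDS G S ≡ anyF S) →
                 PDP G ≈P (X ⊕ const (+ 1)) ^P N ⊖ const (+ 1)
  PDP-nonempty {N} G char i = trans (PDP-count G anyF char i) (trans (by-degree i) (sym (binomial-minus-one N i)))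
    where
    by-degree : ∀ i → poly (dropConst (cnt N anyF)) i ≡ poly (dropConst (choose N)) i
    by-degree zero    = refl
    by-degree (suc i) = cong +_ (cnt-nonempty N (suc i))

  PDP-edgeless : ∀ n → PDP (edgeless (suc n)) ≈P X ^P suc n
  PDP-edgeless n i = trans (PDP-count (edgeless (suc n)) allF (edgeless-PDS (suc n)) i) (trans (by-degree i) (sym (monomial (suc n) i)))
    where
    by-degree : ∀ i → poly (dropConst (cnt (suc n) allF)) i ≡ poly (δ (suc n)) i
    by-degree zero    = refl
    by-degree (suc i) = cong +_ (cnt-full (suc n) (suc i))

  starPDS-ext : ∀ {m} → Extensional (starPDS {m})
  starPDS-ext e = cong₂ _∨_ (e Fin.zero) (atMostOneOut-ext (λ i → e (Fin.suc i)))

  star-count : ∀ m i → dropConst (cnt (suc (suc (suc m))) starPDS) i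
                       ≡ (lin 0 1 ✶ choose (suc (suc m))) i + δ (suc (suc m)) i + (lin (suc (suc m)) 0 ✶ δ (suc m)) i
  star-count m zero = sym (*-zeroʳ (suc (suc m)))
  star-count m (suc i)
    rewrite cnt-split (suc (suc m)) starPDS starPDS-ext (suc i)
          | cnt-atMostOneOut (suc (suc m)) (suc i) | cnt-all (suc (suc m)) i
          | lin-✶ 0 1 (choose (suc (suc m))) (suc i) | lin-✶ (suc (suc m)) 0 (δ (suc m)) (suc i) =
    rearrange (δ (suc m) i) (suc (suc m) * δ (suc m) (suc i)) (choose (suc (suc m)) i)
    where
    rearrange : ∀ a b c → a + b + c ≡ 1 * c + a + (b + 0)
    rearrange = solve-∀

  PDP-star : ∀ m → PDP (star (suc (suc (suc m))))
                   ≈P (X ⊗ (X ⊕ const (+ 1)) ^P suc (suc m)) ⊕ X ^P suc (suc m) ⊕ (const (+ suc (suc m)) ⊗ X ^P suc m)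
  PDP-star m i = trans (PDP-count (star M+1) starPDS (star-PDS m) i)
                       (trans (cong +_ (star-count m i)) (sym (target i)))
    where
    M+1 = suc (suc (suc m))
    target = ⊕-poly _ _ (⊕-poly _ _ (⊗-poly _ _ X≈ (binomial (suc (suc m)))) (monomial (suc (suc m))))
                        (⊗-poly _ _ (const≈ (suc (suc m))) (monomial (suc m)))

  block≈ : ∀ k → (X ⊕ const (+ 1)) ^P (k + 1) ⊖ const (+ 1) ≈P poly (cnt (suc k) anyF)
  block≈ k i = subst (λ b → ((X ⊕ const (+ 1)) ^P b ⊖ const (+ 1)) i ≡ poly (cnt (suc k) anyF) i) (+-comm 1 k)
                     (trans (binomial-minus-one (suc k) i) (cong +_ (sym (cnt-nonempty (suc k) i))))

  blocks≈ : ∀ k n → ((X ⊕ const (+ 1)) ^P (k + 1) ⊖ const (+ 1)) ^P n ≈P poly (cnt (n * suc k) (blocksHit n k))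
  blocks≈ k zero    zero    = refl
  blocks≈ k zero    (suc i) = refl
  blocks≈ k (suc n) i = trans (⊗-poly _ _ (block≈ k) (blocks≈ k n) i) (cong +_ (sym (product i)))
    where
    product = cnt-product (suc k) (n * suc k) (blocksHit (suc n) k) anyF (blocksHit n k)
                          (blocksHit-ext (suc n) k) (blocksHit-join n k)

  blocksHit-empty : ∀ n k → cnt (suc n * suc k) (blocksHit (suc n) k) 0 ≡ 0
  blocksHit-empty n k =
    trans (cnt-product (suc k) (n * suc k) (blocksHit (suc n) k) anyF (blocksHit n k)
                       (blocksHit-ext (suc n) k) (blocksHit-join n k) 0)
          (cong (_* cnt (n * suc k) (blocksHit n k) 0) (cnt-nonempty (suc k) 0))

  PDP-blocks : ∀ n k (G : Adj (suc n * suc k)) → (∀ S → isPDS G S ≡ blocksHit (suc n) k S) →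
               PDP G ≈P ((X ⊕ const (+ 1)) ^P (k + 1) ⊖ const (+ 1)) ^P suc n
  PDP-blocks n k G char i = trans (PDP-count G (blocksHit (suc n) k) char i)
                                  (trans (by-degree i) (sym (blocks≈ k (suc n) i)))
    where
    by-degree : ∀ i → poly (dropConst (cnt (suc n * suc k) (blocksHit (suc n) k))) i
                      ≡ poly (cnt (suc n * suc k) (blocksHit (suc n) k)) i
    by-degree zero    = cong +_ (sym (blocksHit-empty n k))
    by-degree (suc i) = refl

open GraphFamilies
open Coronas using (corona-PDS)
open DominationPolynomials

proposition21 :
  (∀ (n : ℕ) → 1 ≤ n →
      (PDP (complete n) ≈P (((X ⊕ const (+ 1)) ^P n) ⊖ const (+ 1)))
    × (PDP (path n) ≈P (((X ⊕ const (+ 1)) ^P n) ⊖ const (+ 1))))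
  × (∀ (n : ℕ) → 3 ≤ n →
      PDP (cycle n) ≈P (((X ⊕ const (+ 1)) ^P n) ⊖ const (+ 1)))
  × (∀ (n : ℕ) → 4 ≤ n →
      PDP (wheel n) ≈P (((X ⊕ const (+ 1)) ^P n) ⊖ const (+ 1)))
  × (∀ (n : ℕ) → 1 ≤ n →
      PDP (edgeless n) ≈P (X ^P n))
  × (∀ (n : ℕ) → 3 ≤ n →
      PDP (star n) ≈P ((X ⊗ ((X ⊕ const (+ 1)) ^P (n ∸ 1)))
                        ⊕ (X ^P (n ∸ 1))
                        ⊕ (const (+ (n ∸ 1)) ⊗ (X ^P (n ∸ 2)))))
  × (∀ (n : ℕ) (H : Adj n) → IsSimple H → 1 ≤ n → ∀ (k : ℕ) → 1 < k →
      PDP (corona H k) ≈P ((((X ⊕ const (+ 1)) ^P (k + 1)) ⊖ const (+ 1)) ^P n))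
proposition21 =
    (λ { (suc n) _ → PDP-nonempty (complete (suc n)) (PDS≡nonempty (complete (suc n)) (complete-PDS n))
                   , PDP-nonempty (path (suc n)) (PDS≡nonempty (path (suc n)) (path-PDS (suc n))) })
  , (λ { (suc n) _ → PDP-nonempty (cycle (suc n)) (PDS≡nonempty (cycle (suc n)) (cycle-PDS (suc n))) })
  , (λ { (suc n) _ → PDP-nonempty (wheel (suc n)) (PDS≡nonempty (wheel (suc n)) (wheel-PDS n)) })
  , (λ { (suc n) _ → PDP-edgeless n })
  , (λ { _ (s≤s (s≤s (s≤s _))) → PDP-star _ })
  , λ { (suc n) H _ _ _ (s≤s (s≤s _)) → PDP-blocks n _ (corona H _) (corona-PDS H _) }
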